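{- Let $G\in RHL_5$ be any $5$-dimensional restricted hypercube-like graph. Then $fsmp(G)=5$.
   Context: For disjoint graphs $G_0,G_1$ of the same order and a bijection $\phi:V(G_0)\to V(G_1)$, $G_0\oplus_\phi G_1$ is the graph with vertex set $V(G_0)\cup V(G_1)$ and edge set $E(G_0)\cup E(G_1)\cup\{v\phi(v): v\in V(G_0)\}$. $G(8,4)$ is the graph with vertex set $\{v_0,\dots,v_7\}$ and edges $v_iv_j$ whenever $j\equiv i+1$ or $j\equiv i+4 \pmod 8$. The restricted hypercube-like graphs: $RHL_3=\{G(8,4)\}$ (up to isomorphism) and, for $m\geq 4$, $RHL_m=\{G_0\oplus_\phi G_1 : G_0,G_1\in RHL_{m-1},\ \phi \text{ a bijection}\}$. A fractional perfect matching of a graph $H$ is a function $f:E(H)\to[0,1]$ with $\sum_{e\ni v}f(e)=1$ for every vertex $v$. A set $F$ of vertices and/or edges of $H$ is a fractional strong matching preclusion (FSMP) set if $H-F$ (deleting the vertices with their incident edges, and the edges) has no fractional perfect matching; $fsmp(H)$ is the minimum size of an FSMP set.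
   Formalization: The fractional perfect matchings $f$ take rational values in $[0,1]$. -}

module Defs where

open import Data.Bool using (Bool; true; false; _∨_; _∧_)
open import Data.Bool.Properties using (∨-comm)
open import Data.Nat as ℕ using (ℕ; zero; suc; _≡ᵇ_; _%_)
open import Data.Fin using (Fin; zero; suc; toℕ; splitAt)
open import Data.Fin.Properties using (_≟_)
open import Data.Sum using (_⊎_; inj₁; inj₂)
open import Data.Product using (_×_; _,_; Σ; ∃)
open import Data.List using (List; length; map; foldr; allFin)
open import Data.List.Membership.Propositional using (_∈_; _∉_)
open import Data.List.Relation.Unary.All using (All)
open import Data.List.Relation.Unary.Unique.Propositional using (Unique)
open import Data.Rational using (ℚ; 0ℚ; 1ℚ; _+_; _≤_)
open import Relation.Nullary using (¬_)
open import Relation.Nullary.Decidable using (⌊_⌋)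
open import Relation.Binary.PropositionalEquality using (_≡_; refl)
open import Function.Bundles using (_↔_; Inverse)

record Graph (n : ℕ) : Set where
  field
    adj    : Fin n → Fin n → Bool
    sym    : ∀ i j → adj i j ≡ adj j i
    irrefl : ∀ i → adj i i ≡ false
open Graph public

record _≅_ {n m : ℕ} (G : Graph n) (H : Graph m) : Set where
  field
    iso      : Fin n ↔ Fin m
    preserve : ∀ i j → adj G i j ≡ adj H (Inverse.to iso i) (Inverse.to iso j)

edge84 : ℕ → ℕ → Bool
edge84 a b = (b ≡ᵇ ((a ℕ.+ 1) % 8)) ∨ (b ≡ᵇ ((a ℕ.+ 4) % 8))

adj84 : Fin 8 → Fin 8 → Bool
adj84 i j = edge84 (toℕ i) (toℕ j) ∨ edge84 (toℕ j) (toℕ i)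

irrefl84 : ∀ i → adj84 i i ≡ false
irrefl84 zero = refl
irrefl84 (suc zero) = refl
irrefl84 (suc (suc zero)) = refl
irrefl84 (suc (suc (suc zero))) = refl
irrefl84 (suc (suc (suc (suc zero)))) = refl
irrefl84 (suc (suc (suc (suc (suc zero))))) = refl
irrefl84 (suc (suc (suc (suc (suc (suc zero)))))) = refl
irrefl84 (suc (suc (suc (suc (suc (suc (suc zero))))))) = refl

G84 : Graph 8
G84 = record
  { adj = adj84
  ; sym = λ i j → ∨-comm (edge84 (toℕ i) (toℕ j)) (edge84 (toℕ j) (toℕ i))
  ; irrefl = irrefl84 }

⊕adj : ∀ {n} → Graph n → Graph n → (Fin n ↔ Fin n) →
       Fin n ⊎ Fin n → Fin n ⊎ Fin n → Bool
⊕adj G₀ G₁ φ (inj₁ a) (inj₁ b) = adj G₀ a b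
⊕adj G₀ G₁ φ (inj₂ a) (inj₂ b) = adj G₁ a b
⊕adj G₀ G₁ φ (inj₁ a) (inj₂ b) = ⌊ Inverse.to φ a ≟ b ⌋
⊕adj G₀ G₁ φ (inj₂ a) (inj₁ b) = ⌊ Inverse.to φ b ≟ a ⌋

⊕sym : ∀ {n} (G₀ G₁ : Graph n) (φ : Fin n ↔ Fin n) x y →
       ⊕adj G₀ G₁ φ x y ≡ ⊕adj G₀ G₁ φ y x
⊕sym G₀ G₁ φ (inj₁ a) (inj₁ b) = sym G₀ a b
⊕sym G₀ G₁ φ (inj₂ a) (inj₂ b) = sym G₁ a b
⊕sym G₀ G₁ φ (inj₁ a) (inj₂ b) = refl
⊕sym G₀ G₁ φ (inj₂ a) (inj₁ b) = refl

⊕irr : ∀ {n} (G₀ G₁ : Graph n) (φ : Fin n ↔ Fin n) x → ⊕adj G₀ G₁ φ x x ≡ false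
⊕irr G₀ G₁ φ (inj₁ a) = irrefl G₀ a
⊕irr G₀ G₁ φ (inj₂ a) = irrefl G₁ a

_⊕[_]_ : ∀ {n} → Graph n → (Fin n ↔ Fin n) → Graph n → Graph (n ℕ.+ n)
_⊕[_]_ {n} G₀ φ G₁ = record
  { adj = λ i j → ⊕adj G₀ G₁ φ (splitAt n i) (splitAt n j)
  ; sym = λ i j → ⊕sym G₀ G₁ φ (splitAt n i) (splitAt n j)
  ; irrefl = λ i → ⊕irr G₀ G₁ φ (splitAt n i) }

data RHL : ℕ → ∀ {n} → Graph n → Set where
  rhl-base : ∀ {n} {G : Graph n} → G ≅ G84 → RHL 3 G
  rhl-step : ∀ {m n} {G₀ G₁ : Graph n} (φ : Fin n ↔ Fin n) →
             RHL m G₀ → RHL m G₁ → RHL (suc m) (G₀ ⊕[ φ ] G₁)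

-- Vertices are a duplicate-free list; edges are a duplicate-free list of
-- pairs (u , v) with toℕ u < toℕ v and u v an edge of H (one
-- representative per unordered edge).  |F| = #vertices + #edges.

record DelSet {n : ℕ} (H : Graph n) : Set where
  field
    vs      : List (Fin n)
    es      : List (Fin n × Fin n)
    vs-uniq : Unique vs
    es-uniq : Unique es
    es-edge : All (λ { (u , v) → (toℕ u ℕ.< toℕ v) × (adj H u v ≡ true) }) es
open DelSet public

size : ∀ {n} {H : Graph n} → DelSet H → ℕ
size F = length (vs F) ℕ.+ length (es F)

Alive : ∀ {n} {H : Graph n} → DelSet H → Fin n → Set
Alive F v = v ∉ vs F

AliveEdge : ∀ {n} {H : Graph n} → DelSet H → Fin n → Fin n → Set
AliveEdge {H = H} F u v =
  (adj H u v ≡ true) × Alive F u × Alive F v ×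
  ((u , v) ∉ es F) × ((v , u) ∉ es F)

sumℚ : ∀ {n} → (Fin n → ℚ) → ℚ
sumℚ {n} g = foldr _+_ 0ℚ (map g (allFin n))

record FracPerfectMatching {n} {H : Graph n} (F : DelSet H) : Set where
  field
    f       : Fin n → Fin n → ℚ
    f-sym   : ∀ u v → f u v ≡ f v u
    f-lo    : ∀ u v → 0ℚ ≤ f u v
    f-hi    : ∀ u v → f u v ≤ 1ℚ
    f-supp  : ∀ u v → ¬ AliveEdge F u v → f u v ≡ 0ℚ
    f-sum   : ∀ v → Alive F v → sumℚ (f v) ≡ 1ℚ

IsFSMPSet : ∀ {n} {H : Graph n} → DelSet H → Set
IsFSMPSet F = ¬ FracPerfectMatching F

FsmpEq : ∀ {n} → Graph n → ℕ → Set
FsmpEq H k =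
  (Σ (DelSet H) λ F → IsFSMPSet F × size F ≡ k) ×
  (∀ (F : DelSet H) → IsFSMPSet F → k ℕ.≤ size F)

-- Deleting the five neighbours of a vertex isolates it, so fsmp(G) ≤ 5.  For the converse we
-- never handle fractional matchings directly: a permutation σ of the vertices that fixes the
-- deleted ones and moves every survivor along a surviving edge yields one, with weight ½ on
-- each edge x σ(x).  Such covers are built along G = G₀ ⊕ G₁: covers of the two copies
-- combine, and a surviving matching edge a φ(a) lets us delete a from G₀ and φ(a) from G₁ and
-- put a φ(a) back as a 2-cycle.  Because deletions in one copy can be absorbed in this way,
-- the induction hypothesis for RHL₃ and RHL₄ records how many further vertex deletions make a
-- graph with at most four faults coverable; for G(8,4) it is established by an exhaustive,
-- certified search over all sets of at most four faults.
module Submission where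

open import Defs using (Graph; adj; _≅_; adj84; ⊕adj; ⊕sym; _⊕[_]_; RHL; rhl-base; rhl-step)
open import Defs using (DelSet; vs; es; size; Alive; AliveEdge; sumℚ; FracPerfectMatching; IsFSMPSet; FsmpEq)

open import Data.Bool using (Bool; true; false; T; _∧_; _∨_; not; if_then_else_)
import Data.Bool.Properties as Bool
open import Data.Bool.ListAction using (any)
open import Data.Empty using (⊥-elim)
open import Data.Fin using (Fin; zero; suc; toℕ; #_; splitAt; punchIn)
open import Data.Fin.Properties using (_≟_; _<?_; all?; +↔⊎; punchInᵢ≢i)
open import Data.List
  using (List; []; _∷_; _++_; length; map; filter; filterᵇ; allFin; foldr; mapMaybe; concatMap)
open import Data.List.Properties using (length-map; length-++; length-++-sucʳ; map-tabulate)
open import Data.List.Membership.Propositional using (_∈_; _∉_)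
open import Data.List.Membership.Propositional.Properties
  using (∈-map⁺; ∈-map⁻; ∈-++⁺ˡ; ∈-++⁺ʳ; ∈-++⁻; ∈-∃++; ∈-allFin; ∈-filter⁺; ∈-filter⁻)
open import Data.List.Relation.Binary.Permutation.Propositional using (_↭_; ↭-sym; ↭-refl; ↭-swap)
open import Data.List.Relation.Binary.Permutation.Propositional.Properties using (∈-resp-↭)
open import Data.List.Relation.Unary.All as All using (All)
open import Data.List.Relation.Unary.AllPairs using ([]; _∷_; allPairs?)
open import Data.List.Relation.Unary.Any as Any using (Any; here; there; any?)
import Data.List.Relation.Unary.Any.Properties as Anyₚ
open import Data.List.Relation.Unary.Unique.Propositional using (Unique)
import Data.List.Relation.Unary.Unique.Propositional.Properties as Unique
open import Data.Maybe as Maybe using (Maybe; just; nothing; is-just; is-nothing; _<∣>_)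
open import Data.Nat using (ℕ; zero; suc; _≤_; _+_; _∸_; _≡ᵇ_; z≤n; s≤s; s≤s⁻¹)
open import Data.Nat.Properties
  using (_≤?_; ≤-refl; ≤-reflexive; ≤-trans; ≤-antisym; ≰⇒>; ≰⇒≥; m≤n⇒m≤1+n; m≤m+n; m≤n+m;
         m≤n⇒m∸n≡0; +-suc; +-comm; +-identityʳ; +-monoˡ-≤; +-monoʳ-≤; +-cancelˡ-≤; +-cancelʳ-≤;
         ∸-monoˡ-≤; ∸-+-assoc)
open import Data.Product using (Σ; ∃; _×_; _,_; proj₁; proj₂; uncurry)
open import Data.Rational as ℚ using (ℚ; 0ℚ; 1ℚ; ½)
import Data.Rational.Properties as ℚₚ
open import Data.Sum as Sum using (_⊎_; inj₁; inj₂)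
open import Data.Sum.Algebra using (⊎-comm)
open import Data.Sum.Function.Propositional using (_⊎-↔_)
open import Data.Sum.Properties using (inj₁-injective; inj₂-injective; ≡-dec)
open import Function using (_∘_; _∘′_; id)
open import Function.Bundles using (_↔_; Inverse; Injection; _⇔_; mk⇔; mk↔ₛ′; Equivalence)
open import Function.Properties.Inverse using (↔-refl; ↔-sym; ↔-trans; ↔⇒↣)
open import Relation.Binary.Definitions using (DecidableEquality)
open import Relation.Binary.PropositionalEquality
open import Relation.Nullary using (¬_; Dec; yes; no; does; contradiction)
open import Relation.Nullary.Decidable
  using (isYes; T?; map′; from-yes; ¬?; _×-dec_; _⊎-dec_; _→-dec_; dec⇒maybe)
open import Relation.Unary using (Decidable)

open import Algebra.Properties.CommutativeMonoid.Sum ℚₚ.+-0-commutativeMonoid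
  using (sum; ∑-distrib-+; sum-cong-≗; sum-remove; sum-replicate-zero)

open Inverse using (to; from; strictlyInverseˡ; strictlyInverseʳ)
open Equivalence using () renaming (to to ⇒; from to ⇐)

data Fault (V : Set) : Set where
  vertex : V → Fault V
  edge   : V → V → Fault V

Faults : Set → Set
Faults V = List (Fault V)

Adjacency : Set → Set
Adjacency V = V → V → Bool

Undirected : ∀ {V} → Adjacency V → Set
Undirected A = ∀ x y → A x y ≡ A y x

mapFault : ∀ {V W : Set} → (V → W) → Fault V → Fault W
mapFault h (vertex x) = vertex (h x)
mapFault h (edge x y) = edge (h x) (h y)

vertex-injective : ∀ {V} {x y : V} → vertex x ≡ vertex y → x ≡ y
vertex-injective refl = refl

Fault-≡-dec : ∀ {V} → DecidableEquality V → DecidableEquality (Fault V)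
Fault-≡-dec _≟ᵥ_ (vertex x) (vertex y) = map′ (cong vertex) vertex-injective (x ≟ᵥ y)
Fault-≡-dec _≟ᵥ_ (edge x y) (edge u v) =
  map′ (λ (x≡u , y≡v) → cong₂ edge x≡u y≡v) (λ { refl → refl , refl }) ((x ≟ᵥ u) ×-dec (y ≟ᵥ v))
Fault-≡-dec _≟ᵥ_ (vertex _) (edge _ _) = no λ ()
Fault-≡-dec _≟ᵥ_ (edge _ _) (vertex _) = no λ ()

module _ {V : Set} where

  Dead : Faults V → V → Set
  Dead L x = vertex x ∈ L

  Cut : Faults V → V → V → Set
  Cut L x y = edge x y ∈ L ⊎ edge y x ∈ L

  record Usable (A : Adjacency V) (L : Faults V) (x y : V) : Set where
    constructor usable
    field
      adjacent     : A x y ≡ true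
      source-alive : ¬ Dead L x
      target-alive : ¬ Dead L y
      uncut        : ¬ Cut L x y

  record Cover (A : Adjacency V) (L : Faults V) : Set where
    field
      σ            : V ↔ V
      dead-fixed   : ∀ {x} → Dead L x → to σ x ≡ x
      alive-usable : ∀ {x} → ¬ Dead L x → Usable A L x (to σ x)

  data Coverable (A : Adjacency V) : ℕ → Faults V → Set where
    cover  : ∀ {j L} → Cover A L → Coverable A j L
    delete : ∀ {j L} v → ¬ Dead L v → Coverable A j (vertex v ∷ L) → Coverable A (suc j) L

  record Spare (A : Adjacency V) (L : Faults V) (v : V) : Set where
    constructor spare
    field
      alive         : ¬ Dead L v
      cover-without : Cover A (vertex v ∷ L)

  record TwoSpares (A : Adjacency V) (L : Faults V) : Set where
    constructor twoSpares
    field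
      {u v}    : V
      distinct : u ≢ v
      spare-u  : Spare A L u
      spare-v  : Spare A L v

  -- For d = 1 two choices of the deleted survivor are required: a fault outside one copy of
  -- a sum graph blocks the matching edge of at most one of them.
  Repairable : ℕ → Adjacency V → Faults V → Set
  Repairable zero          A L = Cover A L
  Repairable (suc zero)    A L = Cover A L ⊎ TwoSpares A L
  Repairable (suc (suc k)) A L = Coverable A (suc (suc k)) L

-- With s = m − 2 this is the induction hypothesis for RHL_m (m = 3, 4).
Tolerant : ∀ {V} → ℕ → Adjacency V → Set
Tolerant s A = ∀ L → length L ≤ 4 → Repairable (length L ∸ s) A L

Resilient : ∀ {V} → ℕ → Adjacency V → Faults V → Set
Resilient zero    A R = Cover A R
Resilient (suc k) A R = Cover A R × (∀ y → Resilient k A (vertex y ∷ R))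

module _ {V : Set} {A : Adjacency V} {L : Faults V} where

  Usable-weaken : ∀ {i x y} → Usable A (i ∷ L) x y → Usable A L x y
  Usable-weaken (usable a s t u) = usable a (s ∘ there) (t ∘ there) (u ∘ Sum.map there there)

  Usable-sym : Undirected A → ∀ {x y} → Usable A L x y → Usable A L y x
  Usable-sym A-undirected (usable a s t u) = usable (trans (A-undirected _ _) a) t s (u ∘ Sum.swap)

module _ {V : Set} {A : Adjacency V} where

  Coverable-mono : ∀ {i j L} → i ≤ j → Coverable A i L → Coverable A j L
  Coverable-mono _         (cover c)      = cover c
  Coverable-mono (s≤s i≤j) (delete v a w) = delete v a (Coverable-mono i≤j w)

  Coverable₀⇒Cover : ∀ {L} → Coverable A 0 L → Cover A L
  Coverable₀⇒Cover (cover c) = c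

  Cover⇒Repairable : ∀ d {L} → Cover A L → Repairable d A L
  Cover⇒Repairable zero          c = c
  Cover⇒Repairable (suc zero)    c = inj₁ c
  Cover⇒Repairable (suc (suc k)) c = cover c

  Repairable⇒Coverable : ∀ d {L} → Repairable d A L → Coverable A d L
  Repairable⇒Coverable zero          c                                  = cover c
  Repairable⇒Coverable (suc zero)    (inj₁ c)                           = cover c
  Repairable⇒Coverable (suc zero)    (inj₂ (twoSpares _ (spare a c) _)) = delete _ a (cover c)
  Repairable⇒Coverable (suc (suc k)) w                                  = w

  Coverable⇒Repairable : ∀ {d L} → 2 ≤ d → Coverable A d L → Repairable d A L
  Coverable⇒Repairable {suc (suc d)} _        w = w
  Coverable⇒Repairable {suc zero}    (s≤s ())

  Repairable-mono : ∀ {d e L} → d ≤ e → Repairable d A L → Repairable e A L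
  Repairable-mono {zero}        {e}           _   c = Cover⇒Repairable e c
  Repairable-mono {suc zero}    {suc zero}    _   r = r
  Repairable-mono {suc zero}    {suc (suc _)} d≤e r = Coverable-mono d≤e (Repairable⇒Coverable 1 r)
  Repairable-mono {suc (suc _)} {suc (suc _)} d≤e w = Coverable-mono d≤e w
  Repairable-mono {suc (suc _)} {suc zero}    (s≤s ())

  Tolerant⇒Cover : ∀ {s} → Tolerant s A → s ≤ 4 → ∀ R → length R ≤ s → Cover A R
  Tolerant⇒Cover T s≤4 R R≤s =
    subst (λ d → Repairable d A R) (m≤n⇒m∸n≡0 R≤s) (T R (≤-trans R≤s s≤4))

  Tolerant⇒Resilient : ∀ {s} → Tolerant s A → s ≤ 4 → ∀ k R → length R + k ≤ s → Resilient k A R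
  Tolerant⇒Resilient {s} T s≤4 zero R R≤s =
    Tolerant⇒Cover T s≤4 R (≤-trans (m≤m+n (length R) 0) R≤s)
  Tolerant⇒Resilient {s} T s≤4 (suc k) R R+k≤s =
    Tolerant⇒Cover T s≤4 R (≤-trans (m≤m+n (length R) (suc k)) R+k≤s) ,
    λ y → Tolerant⇒Resilient T s≤4 k (vertex y ∷ R) (subst (_≤ s) (+-suc (length R) k) R+k≤s)

  Resilient⇒Cover : ∀ k {R} → Resilient k A R → Cover A R
  Resilient⇒Cover zero    c       = c
  Resilient⇒Cover (suc k) (c , _) = c

module _ {V : Set} (_≟ᵥ_ : DecidableEquality V) where

  open import Data.List.Membership.DecPropositional (Fault-≡-dec _≟ᵥ_) using (_∈?_)

  dead? : ∀ L x → Dec (Dead L x)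
  dead? L x = vertex x ∈? L

  cut? : ∀ L x y → Dec (Cut L x y)
  cut? L x y = (edge x y ∈? L) ⊎-dec (edge y x ∈? L)

  usable? : ∀ (A : Adjacency V) L x y → Dec (Usable A L x y)
  usable? A L x y = map′ (λ (a , s , t , u) → usable a s t u) (λ (usable a s t u) → a , s , t , u)
    ((A x y Bool.≟ true) ×-dec ¬? (dead? L x) ×-dec ¬? (dead? L y) ×-dec ¬? (cut? L x y))

to-injective : ∀ {V W : Set} (f : V ↔ W) {x y} → to f x ≡ to f y → x ≡ y
to-injective f = Injection.injective (↔⇒↣ f)

from-injective : ∀ {V W : Set} (f : V ↔ W) {x y} → from f x ≡ from f y → x ≡ y
from-injective f = to-injective (↔-sym f)

record Isomorphic {V W : Set} (A : Adjacency V) (B : Adjacency W) : Set where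
  field
    bijection : V ↔ W
    preserves : ∀ x y → A x y ≡ B (to bijection x) (to bijection y)

Isomorphic-refl : ∀ {V} {A : Adjacency V} → Isomorphic A A
Isomorphic-refl = record { bijection = ↔-refl ; preserves = λ _ _ → refl }

≅⇒Isomorphic : ∀ {n m} {G : Graph n} {H : Graph m} → G ≅ H → Isomorphic (adj G) (adj H)
≅⇒Isomorphic G≅H = record { bijection = _≅_.iso G≅H ; preserves = _≅_.preserve G≅H }

-- Cuts of non-edges of A are irrelevant, so only the cuts of edges have to correspond.
record Corresponds {V W : Set} (h : V → W) (A : Adjacency V) (L : Faults V) (L′ : Faults W) : Set where
  field
    dead : ∀ x → Dead L x ⇔ Dead L′ (h x)
    cut  : ∀ {x y} → A x y ≡ true → Cut L x y → Cut L′ (h x) (h y)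

Corresponds-↭ : ∀ {V} {A : Adjacency V} {L L′} → L ↭ L′ → Corresponds id A L L′
Corresponds-↭ L↭L′ = record
  { dead = λ _ → mk⇔ (∈-resp-↭ L↭L′) (∈-resp-↭ (↭-sym L↭L′))
  ; cut  = λ _ → Sum.map (∈-resp-↭ L↭L′) (∈-resp-↭ L↭L′) }

module _ {V W : Set} {A : Adjacency V} {B : Adjacency W} (i : Isomorphic A B) where

  open Isomorphic i
  private
    h = to bijection

  Corresponds-map : ∀ L → Corresponds h A L (map (mapFault h) L)
  Corresponds-map L = record
    { dead = λ x → mk⇔ (∈-map⁺ (mapFault h)) (dead⇐ x)
    ; cut  = λ _ → Sum.map (∈-map⁺ (mapFault h)) (∈-map⁺ (mapFault h)) }
    where
    dead⇐ : ∀ x → Dead (map (mapFault h) L) (h x) → Dead L x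
    dead⇐ x m with ∈-map⁻ (mapFault h) m
    ... | vertex y , y∈L , eq = subst (Dead L) (to-injective bijection (vertex-injective (sym eq))) y∈L

  Corresponds-delete : ∀ {L L′} → Corresponds h A L L′ → ∀ w →
                       Corresponds h A (vertex (from bijection w) ∷ L) (vertex w ∷ L′)
  Corresponds-delete corr w = record
    { dead = λ x → mk⇔ (dead⇒ x) (dead⇐ x)
    ; cut  = λ a → Sum.map there there ∘ Corresponds.cut corr a ∘ Sum.map edge-there edge-there }
    where
    edge-there : ∀ {M : Faults V} {v x y} → edge x y ∈ vertex v ∷ M → edge x y ∈ M
    edge-there (there m) = m
    dead⇒ : ∀ x → Dead (vertex (from bijection w) ∷ _) x → Dead (vertex w ∷ _) (h x)
    dead⇒ x (here refl) = here (cong vertex (strictlyInverseˡ bijection w))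
    dead⇒ x (there m)   = there (⇒ (Corresponds.dead corr x) m)
    dead⇐ : ∀ x → Dead (vertex w ∷ _) (h x) → Dead (vertex (from bijection w) ∷ _) x
    dead⇐ x (here eq) = here (cong vertex (sym (Inverse.inverseʳ bijection (sym (vertex-injective eq)))))
    dead⇐ x (there m) = there (⇐ (Corresponds.dead corr x) m)

  Usable-transport : ∀ {L L′} → Corresponds h A L L′ →
                     ∀ {x y} → Usable B L′ (h x) (h y) → Usable A L x y
  Usable-transport corr (usable a s t u) =
    usable (trans (preserves _ _) a) (s ∘ ⇒ (dead _)) (t ∘ ⇒ (dead _)) (u ∘ cut (trans (preserves _ _) a))
    where open Corresponds corr

  Cover-transport : ∀ {L L′} → Corresponds h A L L′ → Cover B L′ → Cover A L
  Cover-transport {L′ = L′} corr c = record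
    { σ            = ↔-trans bijection (↔-trans σ (↔-sym bijection))
    ; dead-fixed   = λ {x} d →
        trans (cong (from bijection) (dead-fixed (⇒ (dead x) d))) (strictlyInverseʳ bijection x)
    ; alive-usable = λ {x} a → Usable-transport corr
        (subst (Usable B L′ (h x)) (sym (strictlyInverseˡ bijection _)) (alive-usable (a ∘ ⇐ (dead x)))) }
    where
    open Cover c
    open Corresponds corr

  alive-transport : ∀ {L L′ w} → Corresponds h A L L′ → ¬ Dead L′ w → ¬ Dead L (from bijection w)
  alive-transport {L′ = L′} {w} corr w-alive =
    w-alive ∘ subst (Dead L′) (strictlyInverseˡ bijection w) ∘ ⇒ (Corresponds.dead corr _)

  Spare-transport : ∀ {L L′ w} → Corresponds h A L L′ → Spare B L′ w → Spare A L (from bijection w)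
  Spare-transport {w = w} corr (spare a c) =
    spare (alive-transport corr a) (Cover-transport (Corresponds-delete corr w) c)

  TwoSpares-transport : ∀ {L L′} → Corresponds h A L L′ → TwoSpares B L′ → TwoSpares A L
  TwoSpares-transport corr (twoSpares u≢v su sv) =
    twoSpares (u≢v ∘ from-injective bijection) (Spare-transport corr su) (Spare-transport corr sv)

  Coverable-transport : ∀ {j L L′} → Corresponds h A L L′ → Coverable B j L′ → Coverable A j L
  Coverable-transport corr (cover c)      = cover (Cover-transport corr c)
  Coverable-transport corr (delete w a r) =
    delete (from bijection w) (alive-transport corr a) (Coverable-transport (Corresponds-delete corr w) r)

  Repairable-transport : ∀ d {L L′} → Corresponds h A L L′ → Repairable d B L′ → Repairable d A L
  Repairable-transport zero          corr c        = Cover-transport corr c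
  Repairable-transport (suc zero)    corr (inj₁ c) = inj₁ (Cover-transport corr c)
  Repairable-transport (suc zero)    corr (inj₂ s) = inj₂ (TwoSpares-transport corr s)
  Repairable-transport (suc (suc k)) corr w        = Coverable-transport corr w

  Repairable-map : ∀ d {L} → Repairable d B (map (mapFault h) L) → Repairable d A L
  Repairable-map d {L} = Repairable-transport d (Corresponds-map L)

  Tolerant-transport : ∀ {s} → Tolerant s B → Tolerant s A
  Tolerant-transport {s} T L L≤4 = Repairable-map (length L ∸ s)
    (subst (λ ℓ → Repairable (ℓ ∸ s) B (map (mapFault h) L)) (length-map (mapFault h) L)
      (T (map (mapFault h) L) (subst (_≤ 4) (sym (length-map (mapFault h) L)) L≤4)))

Cover-exchange : ∀ {V} {A : Adjacency V} {i j R} → Cover A (i ∷ j ∷ R) → Cover A (j ∷ i ∷ R)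
Cover-exchange {i = i} {j} = Cover-transport Isomorphic-refl (Corresponds-↭ (↭-swap j i ↭-refl))

-- Gluing an edge back as a 2-cycle

module _ {V : Set} (_≟ᵥ_ : DecidableEquality V) where

  transpose : V → V → V → V
  transpose a b x with x ≟ᵥ a
  ... | yes _ = b
  ... | no _ with x ≟ᵥ b
  ...   | yes _ = a
  ...   | no _  = x

  transpose-source : ∀ a b → transpose a b a ≡ b
  transpose-source a b with a ≟ᵥ a
  ... | yes _   = refl
  ... | no a≢a = ⊥-elim (a≢a refl)

  transpose-target : ∀ a b → transpose a b b ≡ a
  transpose-target a b with b ≟ᵥ a
  ... | yes b≡a = b≡a
  ... | no _ with b ≟ᵥ b
  ...   | yes _   = refl
  ...   | no b≢b = ⊥-elim (b≢b refl)

  transpose-other : ∀ {a b x} → x ≢ a → x ≢ b → transpose a b x ≡ x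
  transpose-other {a} {b} {x} x≢a x≢b with x ≟ᵥ a
  ... | yes x≡a = ⊥-elim (x≢a x≡a)
  ... | no _ with x ≟ᵥ b
  ...   | yes x≡b = ⊥-elim (x≢b x≡b)
  ...   | no _    = refl

  transpose-involutive : ∀ a b x → transpose a b (transpose a b x) ≡ x
  transpose-involutive a b x = cases (x ≟ᵥ a) (x ≟ᵥ b)
    where
    cases : Dec (x ≡ a) → Dec (x ≡ b) → transpose a b (transpose a b x) ≡ x
    cases (yes refl) _          = trans (cong (transpose a b) (transpose-source a b)) (transpose-target a b)
    cases (no _)     (yes refl) = trans (cong (transpose a b) (transpose-target a b)) (transpose-source a b)
    cases (no x≢a)   (no x≢b)   =
      trans (cong (transpose a b) (transpose-other x≢a x≢b)) (transpose-other x≢a x≢b)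

  transposition : V → V → V ↔ V
  transposition a b =
    mk↔ₛ′ (transpose a b) (transpose a b) (transpose-involutive a b) (transpose-involutive a b)

  glue : ∀ {A : Adjacency V} {L a b} → Undirected A → Usable A L a b →
         Cover A (vertex a ∷ vertex b ∷ L) → Cover A L
  glue {A} {L} {a} {b} A-undirected ab c = record
    { σ            = ↔-trans (transposition a b) σ
    ; dead-fixed   = fixed
    ; alive-usable = moves }
    where
    open Cover c
    fixed : ∀ {x} → Dead L x → to σ (transpose a b x) ≡ x
    fixed {x} d = trans (cong (to σ) (transpose-other x≢a x≢b)) (dead-fixed (there (there d)))
      where
      x≢a : x ≢ a
      x≢a refl = Usable.source-alive ab d
      x≢b : x ≢ b
      x≢b refl = Usable.target-alive ab d
    moves : ∀ {x} → ¬ Dead L x → Usable A L x (to σ (transpose a b x))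
    moves {x} x-alive = cases (x ≟ᵥ a) (x ≟ᵥ b)
      where
      cases : Dec (x ≡ a) → Dec (x ≡ b) → Usable A L x (to σ (transpose a b x))
      cases (yes refl) _ = subst (Usable A L x)
        (sym (trans (cong (to σ) (transpose-source a b)) (dead-fixed (there (here refl))))) ab
      cases (no _) (yes refl) = subst (Usable A L x)
        (sym (trans (cong (to σ) (transpose-target a b)) (dead-fixed (here refl)))) (Usable-sym A-undirected ab)
      cases (no x≢a) (no x≢b) = subst (Usable A L x)
        (sym (cong (to σ) (transpose-other x≢a x≢b))) (Usable-weaken (Usable-weaken (alive-usable alive)))
        where
        alive : ¬ Dead (vertex a ∷ vertex b ∷ L) x
        alive (here refl)         = x≢a refl
        alive (there (here refl)) = x≢b refl
        alive (there (there d))   = x-alive d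

-- Certified search for covers of graphs on Fin n

module _ {V : Set} where

  ValidCover : Adjacency V → Faults V → (V → V) → (V → V) → Set
  ValidCover A L f g =
    ∀ x → g (f x) ≡ x × f (g x) ≡ x × (Dead L x → f x ≡ x) × (¬ Dead L x → Usable A L x (f x))

  ValidCover⇒Cover : ∀ {A L f g} → ValidCover A L f g → Cover A L
  ValidCover⇒Cover {f = f} {g} valid = record
    { σ            = mk↔ₛ′ f g (proj₁ ∘ proj₂ ∘ valid) (proj₁ ∘ valid)
    ; dead-fixed   = λ {x} → proj₁ (proj₂ (proj₂ (valid x)))
    ; alive-usable = λ {x} → proj₂ (proj₂ (proj₂ (valid x))) }

fromIsJust : ∀ {A : Set} (m : Maybe A) → is-just m ≡ true → A
fromIsJust (just a) _ = a

module _ {n : ℕ} where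

  validCover? : ∀ (A : Adjacency (Fin n)) L f g → Dec (ValidCover A L f g)
  validCover? A L f g = all? λ x →
    (g (f x) ≟ x) ×-dec (f (g x) ≟ x) ×-dec (dead? _≟_ L x →-dec (f x ≟ x)) ×-dec
    (¬? (dead? _≟_ L x) →-dec usable? _≟_ A L x (f x))

  -- Kuhn's augmenting-path algorithm matches the survivors with their images along usable
  -- edges.  It is only a heuristic, with Boolean tests for speed: validCover? certifies its result.
  _==_ : Fin n → Fin n → Bool
  x == y = toℕ x ≡ᵇ toℕ y

  hitsVertex : Fin n → Fault (Fin n) → Bool
  hitsVertex x (vertex y) = x == y
  hitsVertex x (edge _ _) = false

  hitsEdge : Fin n → Fin n → Fault (Fin n) → Bool
  hitsEdge x y (vertex _) = false
  hitsEdge x y (edge u v) = (x == u ∧ y == v) ∨ (x == v ∧ y == u)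

  usableᵇ : Adjacency (Fin n) → Faults (Fin n) → Fin n → Fin n → Bool
  usableᵇ A L x y = A x y ∧ not (any (λ i → hitsVertex y i ∨ hitsEdge x y i) L)

  Matching : Set
  Matching = List (Fin n × Fin n)

  owner : Matching → Fin n → Maybe (Fin n)
  owner []             y = nothing
  owner ((x , y′) ∷ m) y = if y′ == y then just x else owner m y

  augment : ℕ → (Fin n → Fin n → Bool) → Matching → Fin n → List (Fin n) →
            Maybe Matching × List (Fin n)
  augment zero       ok m x seen = nothing , seen
  augment (suc fuel) ok m x seen = try (allFin n) seen
    where
    try : List (Fin n) → List (Fin n) → Maybe Matching × List (Fin n)
    try []       seen = nothing , seen
    try (y ∷ ys) seen with not (any (_== y) seen) ∧ ok x y
    ... | false = try ys seen
    ... | true with owner m y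
    ...   | nothing = just ((x , y) ∷ m) , y ∷ seen
    ...   | just x′ with augment fuel ok (filterᵇ (not ∘ (_== y) ∘ proj₂) m) x′ (y ∷ seen)
    ...     | just m′ , seen′ = just ((x , y) ∷ m′) , seen′
    ...     | nothing , seen′ = try ys seen′

  perfectMatching : (Fin n → Fin n → Bool) → List (Fin n) → Maybe Matching
  perfectMatching ok []       = just []
  perfectMatching ok (x ∷ xs) with perfectMatching ok xs
  ... | nothing = nothing
  ... | just m  = proj₁ (augment (suc n) ok m x [])

  follow : Matching → Fin n → Fin n
  follow []             x = x
  follow ((a , b) ∷ m) x = if x == a then b else follow m x

  certifyCover : ∀ (A : Adjacency (Fin n)) L → Maybe (Cover A L)
  certifyCover A L with perfectMatching (usableᵇ A L) (filterᵇ (λ x → not (any (hitsVertex x) L)) (allFin n))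
  ... | nothing = nothing
  ... | just m  = Maybe.map (ValidCover⇒Cover {A = A} {L})
                    (dec⇒maybe (validCover? A L (follow m) (follow (map Data.Product.swap m))))

  firstJust : ∀ {B : Set} → (Fin n → Maybe B) → Maybe B
  firstJust f = foldr (λ x r → f x <∣> r) nothing (allFin n)

  certifyCoverable : ∀ j (A : Adjacency (Fin n)) L → Maybe (Coverable A j L)
  certifyCoverable j A L = Maybe.map cover (certifyCover A L) <∣> deleting j
    where
    deleting : ∀ j → Maybe (Coverable A j L)
    deleting zero    = nothing
    deleting (suc j) = firstJust attempt
      where
      attempt : Fin n → Maybe (Coverable A (suc j) L)
      attempt v with dead? _≟_ L v
      ... | yes _     = nothing
      ... | no v-alive = Maybe.map (delete v v-alive) (certifyCoverable j A (vertex v ∷ L))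

  certifySpare : ∀ (A : Adjacency (Fin n)) L v → Maybe (Spare A L v)
  certifySpare A L v with dead? _≟_ L v
  ... | yes _     = nothing
  ... | no v-alive = Maybe.map (spare v-alive) (certifyCover A (vertex v ∷ L))

  certifyTwoSpares : ∀ (A : Adjacency (Fin n)) L → Maybe (TwoSpares A L)
  certifyTwoSpares A L with mapMaybe (λ v → Maybe.map (v ,_) (certifySpare A L v)) (allFin n)
  ... | (u , su) ∷ (v , sv) ∷ _ with u ≟ v
  ...   | no u≢v = just (twoSpares u≢v su sv)
  ...   | yes _  = nothing
  certifyTwoSpares A L | _ = nothing

  certifyRepairable : ∀ d (A : Adjacency (Fin n)) L → Maybe (Repairable d A L)
  certifyRepairable zero          A L = certifyCover A L
  certifyRepairable (suc zero)    A L =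
    Maybe.map inj₁ (certifyCover A L) <∣> Maybe.map inj₂ (certifyTwoSpares A L)
  certifyRepairable (suc (suc k)) A L = certifyCoverable (suc (suc k)) A L

-- The base case G(8,4)

allSublists : ∀ {A : Set} → ℕ → (List A → Bool) → List A → Bool
allSublists k       p []       = p []
allSublists zero    p (x ∷ xs) = allSublists zero p xs
allSublists (suc k) p (x ∷ xs) = allSublists (suc k) p xs ∧ allSublists k (p ∘ (x ∷_)) xs

allSublists-filter : ∀ {A : Set} k p (xs : List A) → allSublists k p xs ≡ true →
                     ∀ {P : A → Set} (P? : Decidable P) → length (filter P? xs) ≤ k →
                     p (filter P? xs) ≡ true
allSublists-filter k       p []       all-p P? _ = all-p
allSublists-filter zero    p (x ∷ xs) all-p P? len with does (P? x)
... | true  = contradiction len λ ()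
... | false = allSublists-filter zero p xs all-p P? len
allSublists-filter (suc k) p (x ∷ xs) all-p P? len with does (P? x)
... | true  = allSublists-filter k (p ∘ (x ∷_)) xs
                (Bool.∧-conicalʳ (allSublists (suc k) p xs) _ all-p) P? (s≤s⁻¹ len)
... | false = allSublists-filter (suc k) p xs
                (Bool.∧-conicalˡ _ (allSublists k (p ∘ (x ∷_)) xs) all-p) P? len

Unique⇒length≤ : ∀ {A : Set} {xs ys : List A} → Unique xs → (∀ {x} → x ∈ xs → x ∈ ys) →
                 length xs ≤ length ys
Unique⇒length≤ {xs = []}     _            _     = z≤n
Unique⇒length≤ {xs = x ∷ xs} (x∉xs ∷ uxs) xs⊆ys with ∈-∃++ (xs⊆ys (here refl))
... | us , vs , refl = subst (suc (length xs) ≤_) (sym (length-++-sucʳ us x vs))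
  (s≤s (Unique⇒length≤ uxs (λ z∈xs → shrink z∈xs (xs⊆ys (there z∈xs)))))
  where
  shrink : ∀ {z} → z ∈ xs → z ∈ us ++ x ∷ vs → z ∈ us ++ vs
  shrink z∈xs z∈ys with ∈-++⁻ us z∈ys
  ... | inj₁ z∈us         = ∈-++⁺ˡ z∈us
  ... | inj₂ (here refl)  = contradiction refl (All.lookup x∉xs z∈xs)
  ... | inj₂ (there z∈vs) = ∈-++⁺ʳ us z∈vs

open import Data.List.Membership.DecPropositional (Fault-≡-dec (_≟_ {8})) using (_∈?_)
open import Data.List.Relation.Unary.Unique.DecPropositional (Fault-≡-dec (_≟_ {8})) using (unique?)

items84 : Faults (Fin 8)
items84 = map vertex (allFin 8) ++ concatMap edges-above (allFin 8)
  where
  edges-above : Fin 8 → Faults (Fin 8)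
  edges-above x = map (edge x) (filter (λ y → (x <? y) ×-dec (adj84 x y Bool.≟ true)) (allFin 8))

Hit : ∀ {V} → Faults V → Fault V → Set
Hit L (vertex x) = Dead L x
Hit L (edge x y) = Cut L x y

hit? : ∀ (L : Faults (Fin 8)) → Decidable (Hit L)
hit? L (vertex x) = dead? _≟_ L x
hit? L (edge x y) = cut? _≟_ L x y

canonical : Faults (Fin 8) → Faults (Fin 8)
canonical L = filter (hit? L) items84

items84-vertex : ∀ x → vertex x ∈ items84
items84-vertex x = ∈-++⁺ˡ (∈-map⁺ vertex (∈-allFin x))

items84-edge : ∀ x y → adj84 x y ≡ true → edge x y ∈ items84 ⊎ edge y x ∈ items84
items84-edge = from-yes (all? λ x → all? λ y →
  (adj84 x y Bool.≟ true) →-dec ((edge x y ∈? items84) ⊎-dec (edge y x ∈? items84)))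

canonical-corresponds : ∀ L → Corresponds id adj84 L (canonical L)
canonical-corresponds L = record
  { dead = λ x → mk⇔ (∈-filter⁺ (hit? L) (items84-vertex x)) (proj₂ ∘′ ∈-filter⁻ (hit? L) {xs = items84})
  ; cut  = λ {x} {y} x~y cut → Sum.map (λ m → ∈-filter⁺ (hit? L) m cut)
                                        (λ m → ∈-filter⁺ (hit? L) m (Sum.swap cut)) (items84-edge x y x~y) }

-- orient sends every fault to the element of items84 that it hits, hence the pigeonhole bound.
orient : Fault (Fin 8) → Fault (Fin 8)
orient (vertex x) = vertex x
orient (edge x y) = if isYes (x <? y) then edge x y else edge y x

swapEnds : ∀ {V} → Fault V → Fault V
swapEnds (vertex x) = vertex x
swapEnds (edge x y) = edge y x

items84-oriented : All (λ s → orient s ≡ s × orient (swapEnds s) ≡ s) items84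
items84-oriented = from-yes (All.all? (λ s → (orient s ≟ᶠ s) ×-dec (orient (swapEnds s) ≟ᶠ s)) items84)
  where
  _≟ᶠ_ = Fault-≡-dec _≟_

canonical-length : ∀ L → length (canonical L) ≤ length L
canonical-length L = subst (length (canonical L) ≤_) (length-map orient L)
  (Unique⇒length≤ (Unique.filter⁺ (hit? L) (from-yes (unique? items84)))
                  (represented ∘′ ∈-filter⁻ (hit? L) {xs = items84}))
  where
  represented : ∀ {s} → s ∈ items84 × Hit L s → s ∈ map orient L
  represented {vertex x} (_ , x-dead)  = ∈-map⁺ orient x-dead
  represented {edge x y} (s∈ , inj₁ m) =
    subst (_∈ map orient L) (proj₁ (All.lookup items84-oriented s∈)) (∈-map⁺ orient m)
  represented {edge x y} (s∈ , inj₂ m) =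
    subst (_∈ map orient L) (proj₂ (All.lookup items84-oriented s∈)) (∈-map⁺ orient m)

certified : Faults (Fin 8) → Bool
certified S = is-just (certifyRepairable (length S ∸ 1) adj84 S)

-- The 6196 sets of at most four of the 20 vertices and edges of G(8,4).
certificates : allSublists 4 certified items84 ≡ true
certificates = refl

G84-tolerant : Tolerant 1 adj84
G84-tolerant L L≤4 = Repairable-transport Isomorphic-refl (length L ∸ 1) (canonical-corresponds L)
  (Repairable-mono (∸-monoˡ-≤ 1 (canonical-length L)) (fromIsJust (certifyRepairable _ adj84 (canonical L))
    (allSublists-filter 4 certified items84 certificates (hit? L) (≤-trans (canonical-length L) L≤4))))

-- Sum graphs

module _ {A B : Set} {f : A → Maybe B} where

  ∈-mapMaybe⁺ : ∀ {x y xs} → x ∈ xs → f x ≡ just y → y ∈ mapMaybe f xs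
  ∈-mapMaybe⁺ {xs = x ∷ _} (here refl) fx≡y with f x | fx≡y
  ... | just _ | refl = here refl
  ∈-mapMaybe⁺ {xs = x ∷ _} (there m) fx≡y with f x
  ... | just _  = there (∈-mapMaybe⁺ m fx≡y)
  ... | nothing = ∈-mapMaybe⁺ m fx≡y

  ∈-mapMaybe⁻ : ∀ {y} xs → y ∈ mapMaybe f xs → ∃ λ x → x ∈ xs × f x ≡ just y
  ∈-mapMaybe⁻ (x ∷ xs) m with f x in fx≡
  ∈-mapMaybe⁻ (x ∷ xs) (here refl) | just _ = x , here refl , fx≡
  ∈-mapMaybe⁻ (x ∷ xs) (there m)   | just _ with ∈-mapMaybe⁻ xs m
  ... | x′ , x′∈xs , eq = x′ , there x′∈xs , eq
  ∈-mapMaybe⁻ (x ∷ xs) m | nothing with ∈-mapMaybe⁻ xs m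
  ... | x′ , x′∈xs , eq = x′ , there x′∈xs , eq

module _ {V W : Set} where

  inside₀ : Fault (V ⊎ W) → Maybe (Fault V)
  inside₀ (vertex (inj₁ a))        = just (vertex a)
  inside₀ (edge (inj₁ a) (inj₁ b)) = just (edge a b)
  inside₀ _                        = nothing

  inside₁ : Fault (V ⊎ W) → Maybe (Fault W)
  inside₁ (vertex (inj₂ a))        = just (vertex a)
  inside₁ (edge (inj₂ a) (inj₂ b)) = just (edge a b)
  inside₁ _                        = nothing

  left : Faults (V ⊎ W) → Faults V
  left = mapMaybe inside₀

  right : Faults (V ⊎ W) → Faults W
  right = mapMaybe inside₁

  outsideLeft : Faults (V ⊎ W) → Faults (V ⊎ W)
  outsideLeft = filter (T? ∘ is-nothing ∘ inside₀)

  inside₀-sound : ∀ {i j} → inside₀ i ≡ just j → i ≡ mapFault inj₁ j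
  inside₀-sound {vertex (inj₁ a)}        refl = refl
  inside₀-sound {edge (inj₁ a) (inj₁ b)} refl = refl

  inside₁-sound : ∀ {i j} → inside₁ i ≡ just j → i ≡ mapFault inj₂ j
  inside₁-sound {vertex (inj₂ a)}        refl = refl
  inside₁-sound {edge (inj₂ a) (inj₂ b)} refl = refl

  inside₀-complete : ∀ j → inside₀ (mapFault inj₁ j) ≡ just j
  inside₀-complete (vertex a) = refl
  inside₀-complete (edge a b) = refl

  inside₁-complete : ∀ j → inside₁ (mapFault inj₂ j) ≡ just j
  inside₁-complete (vertex a) = refl
  inside₁-complete (edge a b) = refl

  module _ {L : Faults (V ⊎ W)} where

    left⁺ : ∀ {j} → mapFault inj₁ j ∈ L → j ∈ left L
    left⁺ {j} m = ∈-mapMaybe⁺ m (inside₀-complete j)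

    left⁻ : ∀ {j} → j ∈ left L → mapFault inj₁ j ∈ L
    left⁻ m with ∈-mapMaybe⁻ L m
    ... | i , i∈L , eq = subst (_∈ L) (inside₀-sound eq) i∈L

    right⁺ : ∀ {j} → mapFault inj₂ j ∈ L → j ∈ right L
    right⁺ {j} m = ∈-mapMaybe⁺ m (inside₁-complete j)

    right⁻ : ∀ {j} → j ∈ right L → mapFault inj₂ j ∈ L
    right⁻ m with ∈-mapMaybe⁻ L m
    ... | i , i∈L , eq = subst (_∈ L) (inside₁-sound eq) i∈L

  length-left+outsideLeft : ∀ L → length (left L) + length (outsideLeft L) ≡ length L
  length-left+outsideLeft []                           = refl
  length-left+outsideLeft (vertex (inj₁ a) ∷ L)        = cong suc (length-left+outsideLeft L)
  length-left+outsideLeft (edge (inj₁ a) (inj₁ b) ∷ L) = cong suc (length-left+outsideLeft L)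
  length-left+outsideLeft (vertex (inj₂ a) ∷ L)        = trans (+-suc _ _) (cong suc (length-left+outsideLeft L))
  length-left+outsideLeft (edge (inj₁ a) (inj₂ b) ∷ L) = trans (+-suc _ _) (cong suc (length-left+outsideLeft L))
  length-left+outsideLeft (edge (inj₂ a) (inj₁ b) ∷ L) = trans (+-suc _ _) (cong suc (length-left+outsideLeft L))
  length-left+outsideLeft (edge (inj₂ a) (inj₂ b) ∷ L) = trans (+-suc _ _) (cong suc (length-left+outsideLeft L))

  length-right≤outsideLeft : ∀ L → length (right L) ≤ length (outsideLeft L)
  length-right≤outsideLeft []                           = z≤n
  length-right≤outsideLeft (vertex (inj₁ a) ∷ L)        = length-right≤outsideLeft L
  length-right≤outsideLeft (edge (inj₁ a) (inj₁ b) ∷ L) = length-right≤outsideLeft L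
  length-right≤outsideLeft (vertex (inj₂ a) ∷ L)        = s≤s (length-right≤outsideLeft L)
  length-right≤outsideLeft (edge (inj₁ a) (inj₂ b) ∷ L) = m≤n⇒m≤1+n (length-right≤outsideLeft L)
  length-right≤outsideLeft (edge (inj₂ a) (inj₁ b) ∷ L) = m≤n⇒m≤1+n (length-right≤outsideLeft L)
  length-right≤outsideLeft (edge (inj₂ a) (inj₂ b) ∷ L) = s≤s (length-right≤outsideLeft L)

left-swap : ∀ {V W : Set} (L : Faults (V ⊎ W)) → left (map (mapFault Sum.swap) L) ≡ right L
left-swap []                           = refl
left-swap (vertex (inj₁ a) ∷ L)        = left-swap L
left-swap (vertex (inj₂ a) ∷ L)        = cong (vertex a ∷_) (left-swap L)
left-swap (edge (inj₁ a) (inj₁ b) ∷ L) = left-swap L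
left-swap (edge (inj₁ a) (inj₂ b) ∷ L) = left-swap L
left-swap (edge (inj₂ a) (inj₁ b) ∷ L) = left-swap L
left-swap (edge (inj₂ a) (inj₂ b) ∷ L) = cong (edge a b ∷_) (left-swap L)

right-swap : ∀ {V W : Set} (L : Faults (V ⊎ W)) → right (map (mapFault Sum.swap) L) ≡ left L
right-swap []                           = refl
right-swap (vertex (inj₁ a) ∷ L)        = cong (vertex a ∷_) (right-swap L)
right-swap (vertex (inj₂ a) ∷ L)        = right-swap L
right-swap (edge (inj₁ a) (inj₁ b) ∷ L) = cong (edge a b ∷_) (right-swap L)
right-swap (edge (inj₁ a) (inj₂ b) ∷ L) = right-swap L
right-swap (edge (inj₂ a) (inj₁ b) ∷ L) = right-swap L
right-swap (edge (inj₂ a) (inj₂ b) ∷ L) = right-swap L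

m∸1≤m+n∸2 : ∀ a c → 1 ≤ c → a ∸ 1 ≤ a + c ∸ 2
m∸1≤m+n∸2 a (suc c) _ = subst (a ∸ 1 ≤_) (cong (_∸ 2) (sym (+-suc a c))) (∸-monoˡ-≤ 1 (m≤m+n a c))

m∸1+n∸1≤m+o∸2 : ∀ a b c → 1 ≤ a → 1 ≤ b → b ≤ c → a ∸ 1 + (b ∸ 1) ≤ a + c ∸ 2
m∸1+n∸1≤m+o∸2 (suc a) (suc b) (suc c) _ _ (s≤s b≤c) =
  subst (a + b ≤_) (cong (_∸ 1) (sym (+-suc a c))) (+-monoʳ-≤ a b≤c)

2≤m+n∸2 : ∀ a c → 2 ≤ a → 2 ≤ c → 2 ≤ a + c ∸ 2
2≤m+n∸2 (suc (suc a)) (suc (suc c)) _             _             =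
  ≤-trans (s≤s (s≤s z≤n)) (m≤n+m (suc (suc c)) a)
2≤m+n∸2 (suc zero)    _             (s≤s ())       _
2≤m+n∸2 (suc (suc a)) (suc zero)    _             (s≤s ())

m+n≤4⇒m≡3×n≡1 : ∀ {a c} → 3 ≤ a → 1 ≤ c → a + c ≤ 4 → a ≡ 3 × c ≡ 1
m+n≤4⇒m≡3×n≡1 {a} {c} 3≤a 1≤c a+c≤4 =
  ≤-antisym (+-cancelʳ-≤ 1 a 3 (≤-trans (+-monoʳ-≤ a 1≤c) a+c≤4)) 3≤a ,
  ≤-antisym (+-cancelˡ-≤ 3 c 1 (≤-trans (+-monoˡ-≤ c 3≤a) a+c≤4)) 1≤c

-- G₀ ⊕ G₁ on Fin n ⊎ Fin n, where ⊕adj computes by pattern matching; ⊕-split moves the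
-- results to Fin (n + n).
module Sum-graph {n : ℕ} (C₀ C₁ : Graph n) (φ : Fin n ↔ Fin n) where

  open Inverse φ using () renaming (to to φ→)

  φ→-injective : ∀ {a b} → φ→ a ≡ φ→ b → a ≡ b
  φ→-injective = to-injective φ

  G : Adjacency (Fin n ⊎ Fin n)
  G = ⊕adj C₀ C₁ φ

  module _ {L : Faults (Fin n ⊎ Fin n)} where

    alive₀ : ∀ {a} → ¬ Dead (left L) a → ¬ Dead L (inj₁ a)
    alive₀ a-alive = a-alive ∘ left⁺

    alive₁ : ∀ {b} → ¬ Dead (right L) b → ¬ Dead L (inj₂ b)
    alive₁ b-alive = b-alive ∘ right⁺

    Usable-inj₁ : ∀ {a b} → Usable (adj C₀) (left L) a b → Usable G L (inj₁ a) (inj₁ b)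
    Usable-inj₁ (usable e s t u) = usable e (alive₀ s) (alive₀ t) (u ∘ Sum.map left⁺ left⁺)

    Usable-inj₂ : ∀ {a b} → Usable (adj C₁) (right L) a b → Usable G L (inj₂ a) (inj₂ b)
    Usable-inj₂ (usable e s t u) = usable e (alive₁ s) (alive₁ t) (u ∘ Sum.map right⁺ right⁺)

    ⊕-cover : Cover (adj C₀) (left L) → Cover (adj C₁) (right L) → Cover G L
    ⊕-cover c₀ c₁ = record
      { σ            = Cover.σ c₀ ⊎-↔ Cover.σ c₁
      ; dead-fixed   = λ { {inj₁ a} d → cong inj₁ (Cover.dead-fixed c₀ (left⁺ d))
                         ; {inj₂ b} d → cong inj₂ (Cover.dead-fixed c₁ (right⁺ d)) }
      ; alive-usable = λ { {inj₁ a} a-alive → Usable-inj₁ (Cover.alive-usable c₀ (a-alive ∘ left⁻))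
                         ; {inj₂ b} b-alive → Usable-inj₂ (Cover.alive-usable c₁ (b-alive ∘ right⁻)) } }

  ⊕-coverableʳ : ∀ {j L} → Cover (adj C₀) (left L) → Coverable (adj C₁) j (right L) → Coverable G j L
  ⊕-coverableʳ c₀ (cover c₁)           = cover (⊕-cover c₀ c₁)
  ⊕-coverableʳ c₀ (delete b b-alive w) = delete (inj₂ b) (alive₁ b-alive) (⊕-coverableʳ c₀ w)

  ⊕-coverable : ∀ {i j L} → Coverable (adj C₀) i (left L) → Coverable (adj C₁) j (right L) →
                Coverable G (i + j) L
  ⊕-coverable {i} {j} (cover c₀)           w₁ = Coverable-mono (m≤n+m j i) (⊕-coverableʳ c₀ w₁)
  ⊕-coverable         (delete a a-alive w₀) w₁ = delete (inj₁ a) (alive₀ a-alive) (⊕-coverable w₀ w₁)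

  ⊕-spare : ∀ {L a} → Spare (adj C₀) (left L) a → Cover (adj C₁) (right L) → Spare G L (inj₁ a)
  ⊕-spare (spare a-alive c₀) c₁ = spare (alive₀ a-alive) (⊕-cover c₀ c₁)

  ⊕-repairable : ∀ d {L} → Repairable d (adj C₀) (left L) → Cover (adj C₁) (right L) → Repairable d G L
  ⊕-repairable zero          c₀        c₁ = ⊕-cover c₀ c₁
  ⊕-repairable (suc zero)    (inj₁ c₀) c₁ = inj₁ (⊕-cover c₀ c₁)
  ⊕-repairable (suc zero)    (inj₂ (twoSpares u≢v su sv)) c₁ =
    inj₂ (twoSpares (u≢v ∘ inj₁-injective) (⊕-spare su c₁) (⊕-spare sv c₁))
  ⊕-repairable (suc (suc k)) w₀        c₁ =
    Coverable-mono (≤-reflexive (+-identityʳ _)) (⊕-coverable w₀ (cover {j = 0} c₁))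

  Blocks : Fin n → Fault (Fin n ⊎ Fin n) → Set
  Blocks g i =
    vertex (inj₂ (φ→ g)) ≡ i ⊎ edge (inj₁ g) (inj₂ (φ→ g)) ≡ i ⊎ edge (inj₂ (φ→ g)) (inj₁ g) ≡ i

  Blocked : Faults (Fin n ⊎ Fin n) → Fin n → Set
  Blocked L g = Any (Blocks g) L

  cross-usable : ∀ {L g} → ¬ Dead (left L) g → ¬ Blocked L g → Usable G L (inj₁ g) (inj₂ (φ→ g))
  cross-usable {L} {g} g-alive unblocked = usable
    (cong isYes (≡-≟-identity _≟_ refl))
    (alive₀ g-alive)
    (unblocked ∘ Any.map inj₁)
    (unblocked ∘ Sum.[ Any.map (inj₂ ∘ inj₁) , Any.map (inj₂ ∘ inj₂) ])

  Blocks-functional : ∀ {g h i} → Blocks g i → Blocks h i → g ≡ h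
  Blocks-functional (inj₁ refl)        (inj₁ eq)        = sym (φ→-injective (inj₂-injective (vertex-injective eq)))
  Blocks-functional (inj₂ (inj₁ refl)) (inj₂ (inj₁ eq)) = sym (inj₁-injective (source eq))
    where source : ∀ {a b c d : Fin n ⊎ Fin n} → edge a b ≡ edge c d → a ≡ c
          source refl = refl
  Blocks-functional (inj₂ (inj₂ refl)) (inj₂ (inj₂ eq)) = sym (inj₁-injective (target eq))
    where target : ∀ {a b c d : Fin n ⊎ Fin n} → edge a b ≡ edge c d → b ≡ d
          target refl = refl
  Blocks-functional (inj₁ refl)        (inj₂ (inj₁ ()))
  Blocks-functional (inj₁ refl)        (inj₂ (inj₂ ()))
  Blocks-functional (inj₂ (inj₁ refl)) (inj₁ ())
  Blocks-functional (inj₂ (inj₁ refl)) (inj₂ (inj₂ ()))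
  Blocks-functional (inj₂ (inj₂ refl)) (inj₁ ())
  Blocks-functional (inj₂ (inj₂ refl)) (inj₂ (inj₁ ()))

  Blocks⇒outside : ∀ {g i} → Blocks g i → T (is-nothing (inside₀ i))
  Blocks⇒outside (inj₁ refl)        = _
  Blocks⇒outside (inj₂ (inj₁ refl)) = _
  Blocks⇒outside (inj₂ (inj₂ refl)) = _

  Blocked⇒outside : ∀ {L g} → Blocked L g → Any (Blocks g) (outsideLeft L)
  Blocked⇒outside b with Anyₚ.filter⁺ (T? ∘ is-nothing ∘ inside₀) b
  ... | inj₁ b′    = b′
  ... | inj₂ inside = ⊥-elim (inside (Blocks⇒outside (Anyₚ.lookup-result b)))

  blocked? : ∀ L g → Dec (Blocked L g)
  blocked? L g = any? (λ i → (vertex (inj₂ (φ→ g)) ≟ᶠ i) ⊎-dec (edge (inj₁ g) (inj₂ (φ→ g)) ≟ᶠ i) ⊎-dec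
                             (edge (inj₂ (φ→ g)) (inj₁ g) ≟ᶠ i)) L
    where
    _≟ᶠ_ : DecidableEquality (Fault (Fin n ⊎ Fin n))
    _≟ᶠ_ = Fault-≡-dec (≡-dec _≟_ _≟_)

  Blocked-unique : ∀ {L g h} → length (outsideLeft L) ≤ 1 → Blocked L g → Blocked L h → g ≡ h
  Blocked-unique {L} ≤1 bg bh with outsideLeft L | ≤1 | Blocked⇒outside bg | Blocked⇒outside bh
  ... | _ ∷ []    | _         | here g-blocks | here h-blocks = Blocks-functional g-blocks h-blocks
  ... | _ ∷ _ ∷ _ | s≤s ()    | _             | _

  Unblocked : Faults (Fin n ⊎ Fin n) → Set
  Unblocked L = ∀ g → ¬ Dead (left L) g → ¬ Blocked L g

  Unblocked-empty : ∀ {L} → outsideLeft L ≡ [] → Unblocked L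
  Unblocked-empty outside≡[] g _ b = Anyₚ.¬Any[] (subst (Any (Blocks g)) outside≡[] (Blocked⇒outside b))

  Unblocked-delete₀ : ∀ {L g} → Unblocked L → Unblocked (vertex (inj₁ g) ∷ L)
  Unblocked-delete₀ u h h-alive (here (inj₁ ()))
  Unblocked-delete₀ u h h-alive (here (inj₂ (inj₁ ())))
  Unblocked-delete₀ u h h-alive (here (inj₂ (inj₂ ())))
  Unblocked-delete₀ u h h-alive (there b) = u h (h-alive ∘ there) b

  Unblocked-glue : ∀ {L g} → Unblocked L → Unblocked (vertex (inj₁ g) ∷ vertex (inj₂ (φ→ g)) ∷ L)
  Unblocked-glue u h h-alive (here (inj₁ ()))
  Unblocked-glue u h h-alive (here (inj₂ (inj₁ ())))
  Unblocked-glue u h h-alive (here (inj₂ (inj₂ ())))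
  Unblocked-glue u h h-alive (there (here (inj₁ eq))) =
    h-alive (here (cong vertex (φ→-injective (inj₂-injective (vertex-injective eq)))))
  Unblocked-glue u h h-alive (there (here (inj₂ (inj₁ ()))))
  Unblocked-glue u h h-alive (there (here (inj₂ (inj₂ ()))))
  Unblocked-glue u h h-alive (there (there b)) = u h (h-alive ∘ there) b

  cross-glue : ∀ {L g} → ¬ Dead (left L) g → ¬ Blocked L g →
               Cover G (vertex (inj₁ g) ∷ vertex (inj₂ (φ→ g)) ∷ L) → Cover G L
  cross-glue g-alive unblocked = glue (≡-dec _≟_ _≟_) (⊕sym C₀ C₁ φ) (cross-usable g-alive unblocked)

  -- Every deletion of a survivor g of the left copy is either carried out in G or, while k
  -- allows, absorbed: φ(g) is deleted on the right and g φ(g) is glued back as a 2-cycle.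
  absorb : ∀ j k {L} → Unblocked L → Resilient k (adj C₁) (right L) →
           Coverable (adj C₀) (j + k) (left L) → Coverable G j L
  absorb zero    k       u r       (cover c)            = cover (⊕-cover c (Resilient⇒Cover k r))
  absorb (suc j) k       u r       (cover c)            = cover (⊕-cover c (Resilient⇒Cover k r))
  absorb (suc j) k       u r       (delete g g-alive w) =
    delete (inj₁ g) (alive₀ g-alive) (absorb j k (Unblocked-delete₀ u) r w)
  absorb zero    (suc k) u (_ , r) (delete g g-alive w) =
    cover (cross-glue g-alive (u g g-alive) (Coverable₀⇒Cover (absorb zero k (Unblocked-glue u) (r (φ→ g)) w)))

  absorb-repairable : ∀ d {L} → Unblocked L → Resilient 1 (adj C₁) (right L) →
                      Repairable d (adj C₀) (left L) → Repairable (d ∸ 1) G L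
  absorb-repairable zero                u r c = ⊕-cover c (proj₁ r)
  absorb-repairable (suc zero)          u r w = Coverable₀⇒Cover (absorb 0 1 u r (Repairable⇒Coverable 1 w))
  absorb-repairable (suc (suc zero))    u r (cover c) = inj₁ (⊕-cover c (proj₁ r))
  absorb-repairable (suc (suc zero))    u r (delete g g-alive (cover c)) =
    inj₁ (Coverable₀⇒Cover (absorb 0 1 u r (delete g g-alive (cover c))))
  -- g and h are both spares: after deleting either one, the deletion of the other is absorbed.
  absorb-repairable (suc (suc zero)) {L} u r (delete g g-alive (delete h h-alive (cover c))) =
    inj₂ (twoSpares (λ g≡h → h-alive (here (cong vertex (sym (inj₁-injective g≡h)))))
      (spare (alive₀ g-alive)
        (Coverable₀⇒Cover (absorb 0 1 (Unblocked-delete₀ u) r (delete h h-alive (cover c)))))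
      (spare (alive₀ (h-alive ∘ there))
        (Coverable₀⇒Cover (absorb 0 1 (Unblocked-delete₀ u) r (delete g g-alive′ (cover (Cover-exchange c)))))))
    where
    g-alive′ : ¬ Dead (vertex h ∷ left L) g
    g-alive′ (here g≡h) = h-alive (here (sym g≡h))
    g-alive′ (there d)  = g-alive d
  absorb-repairable (suc (suc (suc d))) u r w =
    absorb (suc (suc d)) 1 u r (Coverable-mono (≤-reflexive (sym (+-comm (suc (suc d)) 1))) w)

  module _ (T₀ : Tolerant 1 (adj C₀)) (T₁ : Tolerant 1 (adj C₁)) where

    ⊕-tolerant-oriented : ∀ L → length L ≤ 4 → length (right L) ≤ length (left L) →
                          Repairable (length L ∸ 2) G L
    ⊕-tolerant-oriented L L≤4 b≤a = cases (a ≤? 1) (outsideLeft L) refl (b ≤? 1)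
      where
      a = length (left L)
      b = length (right L)
      c = length (outsideLeft L)
      a+c≡L : a + c ≡ length L
      a+c≡L = length-left+outsideLeft L
      b≤c : b ≤ c
      b≤c = length-right≤outsideLeft L
      a≤4 : a ≤ 4
      a≤4 = ≤-trans (m≤m+n a c) (subst (_≤ 4) (sym a+c≡L) L≤4)
      b≤4 : b ≤ 4
      b≤4 = ≤-trans b≤a a≤4
      1≤4 : 1 ≤ 4
      1≤4 = s≤s z≤n
      cases : Dec (a ≤ 1) → ∀ O → outsideLeft L ≡ O → Dec (b ≤ 1) → Repairable (length L ∸ 2) G L
      cases (yes a≤1) _ _ _ =
        Cover⇒Repairable _
          (⊕-cover (Tolerant⇒Cover T₀ 1≤4 (left L) a≤1) (Tolerant⇒Cover T₁ 1≤4 (right L) (≤-trans b≤a a≤1)))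
      cases (no _) [] outside≡[] _ =
        subst (λ d → Repairable d G L) (trans (∸-+-assoc a 1 1) (cong (_∸ 2) a≡L))
          (absorb-repairable (a ∸ 1) (Unblocked-empty outside≡[]) (Tolerant⇒Resilient T₁ 1≤4 1 (right L) b+1≤1)
            (T₀ (left L) a≤4))
        where
        a≡L : a ≡ length L
        a≡L = trans (sym (+-identityʳ a)) (subst (λ O → a + length O ≡ length L) outside≡[] a+c≡L)
        b+1≤1 : b + 1 ≤ 1
        b+1≤1 = +-monoˡ-≤ 1 (subst (λ O → b ≤ length O) outside≡[] b≤c)
      cases (no _) (_ ∷ _) outside≡ (yes b≤1) =
        subst (λ ℓ → Repairable (ℓ ∸ 2) G L) a+c≡L
          (Repairable-mono (m∸1≤m+n∸2 a c (subst (λ O → 1 ≤ length O) (sym outside≡) (s≤s z≤n)))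
            (⊕-repairable (a ∸ 1) (T₀ (left L) a≤4) (Tolerant⇒Cover T₁ 1≤4 (right L) b≤1)))
      cases (no _) (_ ∷ _) _ (no b≰1) =
        subst (λ ℓ → Repairable (ℓ ∸ 2) G L) a+c≡L
          (Coverable⇒Repairable (2≤m+n∸2 a c 2≤a (≤-trans 2≤b b≤c))
            (Coverable-mono (m∸1+n∸1≤m+o∸2 a b c (≤-trans (s≤s z≤n) 2≤a) (≤-trans (s≤s z≤n) 2≤b) b≤c)
              (⊕-coverable (Repairable⇒Coverable _ (T₀ (left L) a≤4))
                           (Repairable⇒Coverable _ (T₁ (right L) b≤4)))))
        where
        2≤b : 2 ≤ b
        2≤b = ≰⇒> b≰1
        2≤a : 2 ≤ a
        2≤a = ≤-trans 2≤b b≤a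

  spare-glue : ∀ {L g} → Spare (adj C₀) (left L) g → ¬ Blocked L g →
               Cover (adj C₁) (vertex (φ→ g) ∷ right L) → Cover G L
  spare-glue (spare g-alive c₀) unblocked c₁ = cross-glue g-alive unblocked (⊕-cover c₀ c₁)

  module _ (T₀ : Tolerant 2 (adj C₀)) (T₁ : Tolerant 2 (adj C₁)) where

    ⊕-cover-oriented : ∀ L → length L ≤ 4 → length (right L) ≤ length (left L) → Cover G L
    ⊕-cover-oriented L L≤4 b≤a = cases (a ≤? 2) (outsideLeft L) refl
      where
      a = length (left L)
      b = length (right L)
      c = length (outsideLeft L)
      a+c≡L : a + c ≡ length L
      a+c≡L = length-left+outsideLeft L
      b≤c : b ≤ c
      b≤c = length-right≤outsideLeft L
      a+c≤4 : a + c ≤ 4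
      a+c≤4 = subst (_≤ 4) (sym a+c≡L) L≤4
      a≤4 : a ≤ 4
      a≤4 = ≤-trans (m≤m+n a c) a+c≤4
      2≤4 : 2 ≤ 4
      2≤4 = s≤s (s≤s z≤n)
      cases : Dec (a ≤ 2) → ∀ O → outsideLeft L ≡ O → Cover G L
      cases (yes a≤2) _ _ =
        ⊕-cover (Tolerant⇒Cover T₀ 2≤4 (left L) a≤2) (Tolerant⇒Cover T₁ 2≤4 (right L) (≤-trans b≤a a≤2))
      cases (no _) [] outside≡[] =
        Coverable₀⇒Cover (absorb 0 2 (Unblocked-empty outside≡[]) (Tolerant⇒Resilient T₁ 2≤4 2 (right L) b+2≤2)
          (Coverable-mono (∸-monoˡ-≤ 2 a≤4) (Repairable⇒Coverable _ (T₀ (left L) a≤4))))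
        where
        b+2≤2 : b + 2 ≤ 2
        b+2≤2 = +-monoˡ-≤ 2 (subst (λ O → b ≤ length O) outside≡[] b≤c)
      cases (no a≰2) (_ ∷ _) outside≡
        with m+n≤4⇒m≡3×n≡1 (≰⇒> a≰2) (subst (λ O → 1 ≤ length O) (sym outside≡) (s≤s z≤n)) a+c≤4
      ... | a≡3 , c≡1 = repair (subst (λ d → Repairable d (adj C₀) (left L)) (cong (_∸ 2) a≡3) (T₀ (left L) a≤4))
        where
        b≤1 : b ≤ 1
        b≤1 = subst (b ≤_) c≡1 b≤c
        cover₁ : ∀ {g} → Cover (adj C₁) (vertex g ∷ right L)
        cover₁ = Tolerant⇒Cover T₁ 2≤4 _ (s≤s b≤1)
        -- The only fault outside the left copy blocks the matching edge of at most one spare.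
        repair : Cover (adj C₀) (left L) ⊎ TwoSpares (adj C₀) (left L) → Cover G L
        repair (inj₁ c₀) = ⊕-cover c₀ (Tolerant⇒Cover T₁ 2≤4 (right L) (≤-trans b≤1 (s≤s z≤n)))
        repair (inj₂ (twoSpares {u} {v} u≢v su sv)) with blocked? L u | blocked? L v
        ... | no u-free     | _             = spare-glue su u-free cover₁
        ... | yes _         | no v-free     = spare-glue sv v-free cover₁
        ... | yes u-blocked | yes v-blocked =
          ⊥-elim (u≢v (Blocked-unique (≤-reflexive c≡1) u-blocked v-blocked))

module _ {n : ℕ} {C₀ C₁ : Graph n} (φ : Fin n ↔ Fin n) where

  ⊕-split : Isomorphic (adj (C₀ ⊕[ φ ] C₁)) (⊕adj C₀ C₁ φ)
  ⊕-split = record { bijection = +↔⊎ ; preserves = λ _ _ → refl }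

  ⊕-swap : Isomorphic (⊕adj C₀ C₁ φ) (⊕adj C₁ C₀ (↔-sym φ))
  ⊕-swap = record { bijection = ⊎-comm _ _ ; preserves = preserves }
    where
    matched⇔ : ∀ a b → isYes (Inverse.to φ a ≟ b) ≡ isYes (Inverse.from φ b ≟ a)
    matched⇔ a b with Inverse.to φ a ≟ b | Inverse.from φ b ≟ a
    ... | yes _    | yes _     = refl
    ... | no _     | no _      = refl
    ... | yes φa≡b | no ¬q     = ⊥-elim (¬q (Inverse.inverseʳ φ (sym φa≡b)))
    ... | no ¬p    | yes φ⁻b≡a = ⊥-elim (¬p (Inverse.inverseˡ φ (sym φ⁻b≡a)))
    preserves : ∀ x y → ⊕adj C₀ C₁ φ x y ≡ ⊕adj C₁ C₀ (↔-sym φ) (Sum.swap x) (Sum.swap y)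
    preserves (inj₁ a) (inj₁ b) = refl
    preserves (inj₁ a) (inj₂ b) = matched⇔ a b
    preserves (inj₂ a) (inj₁ b) = matched⇔ b a
    preserves (inj₂ a) (inj₂ b) = refl

  private
    swapped : Faults (Fin n ⊎ Fin n) → Faults (Fin n ⊎ Fin n)
    swapped = map (mapFault Sum.swap)

    swapped-length : ∀ L → length (swapped L) ≡ length L
    swapped-length = length-map (mapFault Sum.swap)

    swapped-oriented : ∀ L → ¬ length (right L) ≤ length (left L) →
                       length (right (swapped L)) ≤ length (left (swapped L))
    swapped-oriented L b≰a =
      subst₂ (λ R L₀ → length R ≤ length L₀) (sym (right-swap L)) (sym (left-swap L)) (≰⇒≥ b≰a)

  ⊕-tolerant : Tolerant 1 (adj C₀) → Tolerant 1 (adj C₁) → Tolerant 2 (⊕adj C₀ C₁ φ)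
  ⊕-tolerant T₀ T₁ L L≤4 with length (right L) ≤? length (left L)
  ... | yes b≤a = Sum-graph.⊕-tolerant-oriented C₀ C₁ φ T₀ T₁ L L≤4 b≤a
  ... | no b≰a  = Repairable-map ⊕-swap (length L ∸ 2)
    (subst (λ ℓ → Repairable (ℓ ∸ 2) _ (swapped L)) (swapped-length L)
      (Sum-graph.⊕-tolerant-oriented C₁ C₀ (↔-sym φ) T₁ T₀ (swapped L)
        (subst (_≤ 4) (sym (swapped-length L)) L≤4) (swapped-oriented L b≰a)))

  ⊕-covers : Tolerant 2 (adj C₀) → Tolerant 2 (adj C₁) →
             ∀ L → length L ≤ 4 → Cover (⊕adj C₀ C₁ φ) L
  ⊕-covers T₀ T₁ L L≤4 with length (right L) ≤? length (left L)
  ... | yes b≤a = Sum-graph.⊕-cover-oriented C₀ C₁ φ T₀ T₁ L L≤4 b≤a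
  ... | no b≰a  = Repairable-map ⊕-swap 0
    (Sum-graph.⊕-cover-oriented C₁ C₀ (↔-sym φ) T₁ T₀ (swapped L)
      (subst (_≤ 4) (sym (swapped-length L)) L≤4) (swapped-oriented L b≰a))

-- Fractional perfect matchings from covers

sumℚ-suc : ∀ {n} (g : Fin (suc n) → ℚ) → sumℚ g ≡ g zero ℚ.+ sumℚ (g ∘ suc)
sumℚ-suc {n} g = cong (λ xs → g zero ℚ.+ foldr ℚ._+_ 0ℚ xs)
  (trans (map-tabulate suc g) (sym (map-tabulate (λ i → i) (g ∘ suc))))

sumℚ≡sum : ∀ {n} (g : Fin n → ℚ) → sumℚ g ≡ sum g
sumℚ≡sum {zero}  g = refl
sumℚ≡sum {suc n} g = trans (sumℚ-suc g) (cong (g zero ℚ.+_) (sumℚ≡sum (g ∘ suc)))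

weight : Bool → ℚ
weight true  = ½
weight false = 0ℚ

isYes-true : ∀ {P : Set} (p? : Dec P) → P → isYes p? ≡ true
isYes-true (yes _) _ = refl
isYes-true (no ¬p) p = ⊥-elim (¬p p)

isYes⇒ : ∀ {P : Set} (p? : Dec P) → isYes p? ≡ true → P
isYes⇒ (yes p) _ = p

isYes-false : ∀ {P : Set} (p? : Dec P) → ¬ P → isYes p? ≡ false
isYes-false (yes p) ¬p = ⊥-elim (¬p p)
isYes-false (no _)  _  = refl

sum-indicator : ∀ {n} (a : Fin n) → sum (λ v → weight (isYes (a ≟ v))) ≡ ½
sum-indicator {suc m} a = begin
  sum t                        ≡⟨ sum-remove {i = a} t ⟩
  t a ℚ.+ sum (t ∘ punchIn a)  ≡⟨ cong₂ ℚ._+_ (cong weight (isYes-true (a ≟ a) refl)) (sum-cong-≗ off-a) ⟩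
  ½ ℚ.+ sum {m} (λ _ → 0ℚ)     ≡⟨ cong (½ ℚ.+_) (sum-replicate-zero m) ⟩
  ½ ℚ.+ 0ℚ                     ≡⟨ ℚₚ.+-identityʳ ½ ⟩
  ½                            ∎
  where
  open ≡-Reasoning
  t : Fin (suc m) → ℚ
  t v = weight (isYes (a ≟ v))
  off-a : ∀ j → t (punchIn a j) ≡ 0ℚ
  off-a j = cong weight (isYes-false (a ≟ punchIn a j) (punchInᵢ≢i a j ∘ sym))

module _ {n} {H : Graph n} (F : DelSet H) where

  faultsOf : Faults (Fin n)
  faultsOf = map vertex (vs F) ++ map (uncurry edge) (es F)

  length-faultsOf : length faultsOf ≡ size F
  length-faultsOf = trans (length-++ (map vertex (vs F)))
    (cong₂ _+_ (length-map vertex (vs F)) (length-map (uncurry edge) (es F)))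

  Dead-faultsOf⁺ : ∀ {x} → x ∈ vs F → Dead faultsOf x
  Dead-faultsOf⁺ = ∈-++⁺ˡ ∘ ∈-map⁺ vertex

  Dead-faultsOf⁻ : ∀ {x} → Dead faultsOf x → x ∈ vs F
  Dead-faultsOf⁻ d with ∈-++⁻ (map vertex (vs F)) d
  ... | inj₁ d′ with ∈-map⁻ vertex d′
  ...   | y , y∈vs , eq = subst (_∈ vs F) (sym (vertex-injective eq)) y∈vs
  Dead-faultsOf⁻ d | inj₂ d′ with ∈-map⁻ (uncurry edge) d′
  ...   | _ , _ , ()

  edge-faultsOf⁺ : ∀ {x y} → (x , y) ∈ es F → edge x y ∈ faultsOf
  edge-faultsOf⁺ = ∈-++⁺ʳ (map vertex (vs F)) ∘ ∈-map⁺ (uncurry edge)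

  Usable⇒AliveEdge : ∀ {u v} → Usable (adj H) faultsOf u v → AliveEdge F u v
  Usable⇒AliveEdge (usable a s t u) =
    a , s ∘ Dead-faultsOf⁺ , t ∘ Dead-faultsOf⁺ , u ∘ inj₁ ∘ edge-faultsOf⁺ , u ∘ inj₂ ∘ edge-faultsOf⁺

isYes-cong : ∀ {P Q : Set} (p? : Dec P) (q? : Dec Q) → (P → Q) → (Q → P) → isYes p? ≡ isYes q?
isYes-cong p? q? P→Q Q→P with p? | q?
... | yes _ | yes _ = refl
... | no _  | no _  = refl
... | yes p | no ¬q = ⊥-elim (¬q (P→Q p))
... | no ¬p | yes q = ⊥-elim (¬p (Q→P q))

weight-bounds : ∀ b b′ → 0ℚ ℚ.≤ weight b ℚ.+ weight b′ × weight b ℚ.+ weight b′ ℚ.≤ 1ℚ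
weight-bounds b b′ = ℚₚ.+-mono-≤ (nonneg b) (nonneg b′) , ℚₚ.+-mono-≤ (≤½ b) (≤½ b′)
  where
  nonneg : ∀ b → 0ℚ ℚ.≤ weight b
  nonneg true  = from-yes (0ℚ ℚₚ.≤? ½)
  nonneg false = ℚₚ.≤-refl
  ≤½ : ∀ b → weight b ℚ.≤ ½
  ≤½ true  = ℚₚ.≤-refl
  ≤½ false = from-yes (0ℚ ℚₚ.≤? ½)

module _ {n} {H : Graph n} {F : DelSet H} (c : Cover (adj H) (faultsOf F)) where

  open Cover c
  private
    σ→ = Inverse.to σ
    σ← = Inverse.from σ
    usable-at? = usable? _≟_ (adj H) (faultsOf F)
    δ : Fin n → Fin n → ℚ
    δ a b = weight (isYes (a ≟ b))

  weights : Fin n → Fin n → ℚ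
  weights u v = if isYes (usable-at? u v) then δ (σ→ u) v ℚ.+ δ (σ→ v) u else 0ℚ

  weights-sym : ∀ u v → weights u v ≡ weights v u
  weights-sym u v
    rewrite isYes-cong (usable-at? u v) (usable-at? v u) (Usable-sym (Graph.sym H)) (Usable-sym (Graph.sym H))
    with isYes (usable-at? v u)
  ... | true  = ℚₚ.+-comm (δ (σ→ u) v) (δ (σ→ v) u)
  ... | false = refl

  weights-lo : ∀ u v → 0ℚ ℚ.≤ weights u v
  weights-lo u v with isYes (usable-at? u v)
  ... | true  = proj₁ (weight-bounds (isYes (σ→ u ≟ v)) (isYes (σ→ v ≟ u)))
  ... | false = ℚₚ.≤-refl

  weights-hi : ∀ u v → weights u v ℚ.≤ 1ℚ
  weights-hi u v with isYes (usable-at? u v)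
  ... | true  = proj₂ (weight-bounds (isYes (σ→ u ≟ v)) (isYes (σ→ v ≟ u)))
  ... | false = from-yes (0ℚ ℚₚ.≤? 1ℚ)

  weights-supp : ∀ u v → ¬ AliveEdge F u v → weights u v ≡ 0ℚ
  weights-supp u v ¬alive with usable-at? u v
  ... | yes p = ⊥-elim (¬alive (Usable⇒AliveEdge F p))
  ... | no _  = refl

  weights-survivor : ∀ {u} → ¬ Dead (faultsOf F) u → ∀ v → weights u v ≡ δ (σ→ u) v ℚ.+ δ (σ← u) v
  weights-survivor {u} u-alive v with usable-at? u v
  ... | yes _ = cong (δ (σ→ u) v ℚ.+_) (cong weight
          (isYes-cong (σ→ v ≟ u) (σ← u ≟ v) (Inverse.inverseʳ σ ∘ sym) (Inverse.inverseˡ σ ∘ sym)))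
  ... | no ¬usable =
    sym (cong₂ ℚ._+_ (cong weight (isYes-false (σ→ u ≟ v) σu≢v)) (cong weight (isYes-false (σ← u ≟ v) σ⁻¹u≢v)))
    where
    σu≢v : σ→ u ≢ v
    σu≢v refl = ¬usable (alive-usable u-alive)
    σ⁻¹u≢v : σ← u ≢ v
    σ⁻¹u≢v σ⁻¹u≡v with dead? _≟_ (faultsOf F) v
    ... | yes v-dead = u-alive (subst (Dead (faultsOf F)) (trans (sym (dead-fixed v-dead)) σv≡u) v-dead)
      where σv≡u = Inverse.inverseˡ σ (sym σ⁻¹u≡v)
    ... | no v-alive = ¬usable (Usable-sym (Graph.sym H)
            (subst (Usable (adj H) (faultsOf F) v) (Inverse.inverseˡ σ (sym σ⁻¹u≡v)) (alive-usable v-alive)))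

  weights-sum : ∀ u → Alive F u → sumℚ (weights u) ≡ 1ℚ
  weights-sum u u-alive = begin
    sumℚ (weights u)                       ≡⟨ sumℚ≡sum (weights u) ⟩
    sum (weights u)                        ≡⟨ sum-cong-≗ (weights-survivor (u-alive ∘ Dead-faultsOf⁻ F)) ⟩
    sum (λ v → δ (σ→ u) v ℚ.+ δ (σ← u) v)  ≡⟨ ∑-distrib-+ (δ (σ→ u)) (δ (σ← u)) ⟩
    sum (δ (σ→ u)) ℚ.+ sum (δ (σ← u))      ≡⟨ cong₂ ℚ._+_ (sum-indicator (σ→ u)) (sum-indicator (σ← u)) ⟩
    ½ ℚ.+ ½                                ≡⟨⟩
    1ℚ                                     ∎
    where open ≡-Reasoning

  Cover⇒FracPerfectMatching : FracPerfectMatching F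
  Cover⇒FracPerfectMatching = record
    { f = weights ; f-sym = weights-sym ; f-lo = weights-lo ; f-hi = weights-hi
    ; f-supp = weights-supp ; f-sum = weights-sum }

record Isolation {V : Set} (A : Adjacency V) (m : ℕ) : Set where
  field
    centre           : V
    ring             : List V
    ring-unique      : Unique ring
    ring-length      : length ring ≡ m
    centre∉ring      : centre ∉ ring
    neighbours⊆ring  : ∀ u → A centre u ≡ true → u ∈ ring

module _ {V W : Set} {A : Adjacency V} {B : Adjacency W} (i : Isomorphic A B) where

  open Isomorphic i
  private
    h = to bijection
    h⁻¹ = from bijection

  Isolation-transport : ∀ {m} → Isolation B m → Isolation A m
  Isolation-transport I = record
    { centre          = h⁻¹ centre
    ; ring            = map h⁻¹ ring
    ; ring-unique     = Unique.map⁺ (from-injective bijection) ring-unique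
    ; ring-length     = trans (length-map h⁻¹ ring) ring-length
    ; centre∉ring     = centre∉ring ∘ pulled-back
    ; neighbours⊆ring = λ u adjacent → subst (_∈ map h⁻¹ ring) (strictlyInverseʳ bijection u)
        (∈-map⁺ h⁻¹ (neighbours⊆ring (h u) (trans (cong (λ c → B c (h u)) (sym (strictlyInverseˡ bijection centre)))
                                                (trans (sym (preserves _ u)) adjacent)))) }
    where
    open Isolation I
    pulled-back : ∀ {w} → h⁻¹ w ∈ map h⁻¹ ring → w ∈ ring
    pulled-back m with ∈-map⁻ h⁻¹ m
    ... | w′ , w′∈ , eq = subst (_∈ ring) (sym (from-injective bijection eq)) w′∈

⊕-isolation : ∀ {n m} {C₀ C₁ : Graph n} (φ : Fin n ↔ Fin n) →
              Isolation (adj C₀) m → Isolation (⊕adj C₀ C₁ φ) (suc m)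
⊕-isolation {C₀ = C₀} φ I = record
  { centre          = inj₁ centre
  ; ring            = inj₂ (Inverse.to φ centre) ∷ map inj₁ ring
  ; ring-unique     = All.tabulate inj₂∉ ∷ Unique.map⁺ inj₁-injective ring-unique
  ; ring-length     = cong suc (trans (length-map inj₁ ring) ring-length)
  ; centre∉ring     = λ { (here ()) ; (there m) → centre∉ring (∈-map-inj₁ m) }
  ; neighbours⊆ring = λ { (inj₁ b) adjacent → there (∈-map⁺ inj₁ (neighbours⊆ring b adjacent))
                        ; (inj₂ b) adjacent → here (cong inj₂ (sym (isYes⇒ (Inverse.to φ centre ≟ b) adjacent))) } }
  where
  open Isolation I
  ∈-map-inj₁ : ∀ {a} → inj₁ a ∈ map inj₁ ring → a ∈ ring
  ∈-map-inj₁ m with ∈-map⁻ inj₁ m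
  ... | a′ , a′∈ , eq = subst (_∈ ring) (sym (inj₁-injective eq)) a′∈
  inj₂∉ : ∀ {x} → x ∈ map inj₁ ring → inj₂ (Inverse.to φ centre) ≢ x
  inj₂∉ m refl with ∈-map⁻ inj₁ m
  ... | _ , _ , ()

G84-isolation : Isolation adj84 3
G84-isolation = record
  { centre          = # 0
  ; ring            = ring
  ; ring-unique     = from-yes (allPairs? (λ u v → ¬? (u ≟ v)) ring)
  ; ring-length     = refl
  ; centre∉ring     = from-yes (¬? (any? (# 0 ≟_) ring))
  ; neighbours⊆ring = from-yes (all? λ u → (adj84 (# 0) u Bool.≟ true) →-dec any? (u ≟_) ring) }
  where
  ring : List (Fin 8)
  ring = # 1 ∷ # 7 ∷ # 4 ∷ []

RHL-isolation : ∀ {m n} {G : Graph n} → RHL m G → Isolation (adj G) m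
RHL-isolation (rhl-base G≅G84)   = Isolation-transport (≅⇒Isomorphic G≅G84) G84-isolation
RHL-isolation (rhl-step φ r₀ _) = Isolation-transport (⊕-split φ) (⊕-isolation φ (RHL-isolation r₀))

isolating-set : ∀ {n m} {G : Graph n} → Isolation (adj G) m → Σ (DelSet G) λ F → IsFSMPSet F × size F ≡ m
isolating-set {n} {G = G} I = F , no-matching , trans (+-identityʳ (length ring)) ring-length
  where
  open Isolation I
  F : DelSet G
  F = record { vs = ring ; es = [] ; vs-uniq = ring-unique ; es-uniq = [] ; es-edge = All.[] }
  no-matching : IsFSMPSet F
  no-matching fpm = 0ℚ≢1ℚ (begin
    0ℚ                      ≡⟨ sym (sum-replicate-zero n) ⟩
    sum {n} (λ _ → 0ℚ)      ≡⟨ sum-cong-≗ (sym ∘ isolated) ⟩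
    sum (f centre)          ≡⟨ sym (sumℚ≡sum (f centre)) ⟩
    sumℚ (f centre)         ≡⟨ f-sum centre centre∉ring ⟩
    1ℚ                      ∎)
    where
    open FracPerfectMatching fpm
    open ≡-Reasoning
    0ℚ≢1ℚ : 0ℚ ≢ 1ℚ
    0ℚ≢1ℚ ()
    isolated : ∀ u → f centre u ≡ 0ℚ
    isolated u = f-supp centre u λ (adjacent , _ , u-alive , _) → u-alive (neighbours⊆ring u adjacent)

RHL-dimension : ∀ {m n} {G : Graph n} → RHL m G → 3 ≤ m
RHL-dimension (rhl-base _)     = ≤-refl
RHL-dimension (rhl-step _ r _) = m≤n⇒m≤1+n (RHL-dimension r)

RHL₃-tolerant : ∀ {n} {G : Graph n} → RHL 3 G → Tolerant 1 (adj G)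
RHL₃-tolerant (rhl-base G≅G84) = Tolerant-transport (≅⇒Isomorphic G≅G84) {1} G84-tolerant
RHL₃-tolerant (rhl-step _ r _) with RHL-dimension r
... | s≤s (s≤s ())

RHL₄-tolerant : ∀ {n} {G : Graph n} → RHL 4 G → Tolerant 2 (adj G)
RHL₄-tolerant (rhl-step φ r₀ r₁) =
  Tolerant-transport (⊕-split φ) {2} (⊕-tolerant φ (RHL₃-tolerant r₀) (RHL₃-tolerant r₁))

RHL₅-covers : ∀ {n} {G : Graph n} → RHL 5 G → ∀ L → length L ≤ 4 → Cover (adj G) L
RHL₅-covers (rhl-step φ r₀ r₁) L L≤4 = Repairable-map (⊕-split φ) 0
  (⊕-covers φ (RHL₄-tolerant r₀) (RHL₄-tolerant r₁) (map (mapFault (splitAt _)) L)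
    (subst (_≤ 4) (sym (length-map _ L)) L≤4))

fsmp-lower : ∀ {n} {G : Graph n} → (∀ L → length L ≤ 4 → Cover (adj G) L) →
             ∀ (F : DelSet G) → IsFSMPSet F → 5 ≤ size F
fsmp-lower covers F no-matching with size F ≤? 4
... | yes F≤4 = ⊥-elim (no-matching (Cover⇒FracPerfectMatching {F = F}
                  (covers (faultsOf F) (subst (_≤ 4) (sym (length-faultsOf F)) F≤4))))
... | no F≰4  = ≰⇒> F≰4

lemma3p6 : ∀ {n : ℕ} (G : Graph n) → RHL 5 G → FsmpEq G 5
lemma3p6 G r = isolating-set (RHL-isolation r) , fsmp-lower (RHL₅-covers {G = G} r)
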